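{- Fix an integer $h\ge3$. For each integer $m\ge2$ let $F_m$ be the complete $m$-ary tree of depth $h$ (rooted; every vertex at depth $0,\dots,h-1$ has exactly $m$ children, so leaves are at depth $h$), and let $U_m\subseteq V(F_m)$ be arbitrary. Then there exist constants $C,\gamma>0$ depending only on $h$ and arbitrarily large $n$ for which there is a $2$-closed graph $G_n$ on $n$ vertices and some $m\ge 2$ such that the number of sets $S\subseteq V(G_n)$ with $G_n[S]$ a maximal $U_m$-clique prescribed blow-up of $F_m$ is at least $\exp(Cn^{\gamma})$.
   Context: A graph is $c$-closed if any two distinct non-adjacent vertices have fewer than $c$ common neighbours. Given $H$ with $V(H)=\{1,\dots,k\}$ and $U\subseteq V(H)$, a $U$-clique prescribed blow-up of $H$ is a graph whose vertex set is partitioned into nonempty sets $V_1\sqcup\dots\sqcup V_k$ with $V_i$ complete to $V_j$ whenever $ij\in E(H)$ and $V_i$ a clique for $i\in U$. For $S\subseteq V(G)$, $G[S]$ is a maximal such blow-up if it is one and there is no $S'$ with $S\subsetneq S'\subseteq V(G)$ such that $G[S']$ is one. -}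

module Defs where

open import Data.Nat using (ℕ; _≤_)
open import Data.Fin using (Fin)
open import Data.Fin.Subset using (Subset; _∈_; _⊂_)
open import Data.List using (List; []; _∷_; length)
open import Data.Product using (Σ; ∃; _×_; _,_; proj₁)
open import Data.Sum using (_⊎_)
open import Relation.Binary.PropositionalEquality using (_≡_; _≢_)
open import Relation.Nullary using (¬_)

record Graph (n : ℕ) : Set₁ where
  field
    Adj    : Fin n → Fin n → Set
    sym    : ∀ {u v} → Adj u v → Adj v u
    irrefl : ∀ {u} → ¬ Adj u u
open Graph public

-- c-closed: any two distinct non-adjacent vertices have fewer than c common
-- neighbours. For c = 2: no two distinct common neighbours.
TwoClosed : ∀ {n} → Graph n → Set
TwoClosed {n} G =
  ∀ (u v : Fin n) → u ≢ v → ¬ Adj G u v →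
  ¬ (Σ (Fin n) λ w₁ → Σ (Fin n) λ w₂ →
       w₁ ≢ w₂ × Adj G u w₁ × Adj G v w₁ × Adj G u w₂ × Adj G v w₂)

-- Complete m-ary tree of depth h: vertices are words over Fin m of length ≤ h
-- (root = empty word); w' is a child of w iff w' = c ∷ w for some letter c.
TreeV : ℕ → ℕ → Set
TreeV m h = Σ (List (Fin m)) λ w → length w ≤ h

ChildOf : ∀ {m h} → TreeV m h → TreeV m h → Set
ChildOf {m} x y = Σ (Fin m) λ c → proj₁ x ≡ c ∷ proj₁ y

TreeAdj : ∀ {m h} → TreeV m h → TreeV m h → Set
TreeAdj x y = ChildOf x y ⊎ ChildOf y x

-- G[S] is a U-clique prescribed blow-up of the graph H = (V, E):
-- a map φ from S to V(H) with every part nonempty, parts V_i, V_j complete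
-- to each other when ij ∈ E(H), and V_i a clique when i ∈ U.
IsBlowUp : ∀ {n} (G : Graph n) (V : Set) (E : V → V → Set) (U : V → Set) →
           Subset n → Set
IsBlowUp {n} G V E U S =
  Σ (Fin n → V) λ φ →
    (∀ (x : V) → Σ (Fin n) λ v → v ∈ S × φ v ≡ x)
  × (∀ (u v : Fin n) → u ∈ S → v ∈ S → E (φ u) (φ v) → Adj G u v)
  × (∀ (u v : Fin n) → u ∈ S → v ∈ S → u ≢ v → φ u ≡ φ v → U (φ u) → Adj G u v)

IsMaximalBlowUp : ∀ {n} (G : Graph n) (V : Set) (E : V → V → Set) (U : V → Set) →
                  Subset n → Set
IsMaximalBlowUp {n} G V E U S =
  IsBlowUp G V E U S × (∀ (S' : Subset n) → S ⊂ S' → ¬ IsBlowUp G V E U S')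

-- Write h = t + 3 and m = k + 2. The host graph is the complete m-ary tree of depth h in which
-- every vertex at depth h - 2 gets one extra child; as a forest it is 2-closed. Labelling the
-- extra child 0 and letting `lower` identify it with the child 1, deleting (with its subtree)
-- one of these two twins below every vertex q at depth h - 2 leaves a copy of F_m. The twin
-- may be chosen by a function β of the last letter of q, giving 2^m distinct copies, while
-- n = (m + 2)^h ≤ (2m)^h.
-- Each copy S is a maximal blow-up. In a blow-up on S′ ⊋ S, a fibre over a non-leaf of F_m is a
-- single vertex (two vertices of a fibre would share the representatives of two neighbours),
-- and a leaf of the host lies over a leaf of F_m (its only neighbour is its parent). A vertex
-- of S′ ∖ S lies at or below a deleted twin, under some q; then each of the m + 1 children of q
-- has a host leaf below it in S′, which forces that child into S′ over a child of the image of
-- q. By pigeonhole two of them share a fibre over a non-leaf: a contradiction.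
module Submission where

open import Defs hiding (sym)
open import Data.Empty using (⊥; ⊥-elim)
open import Data.Fin using (Fin; zero; suc; _≟_; combine)
open import Data.Fin.Base using (finToFun; funToFin)
open import Data.Fin.Properties using (finToFun-funToFin; funToFin-finToFin; pigeonhole)
import Data.Fin.Properties as Fin
open import Data.Fin.Subset using (Subset; _∈_; _⊆_)
open import Data.List using (List; []; _∷_; length; map; replicate)
open import Data.List.Properties using (∷-injectiveˡ; ∷-injectiveʳ; length-map; length-replicate)
import Data.Nat as ℕ
open import Data.Nat using (ℕ; zero; suc; _+_; _*_; _^_; _≤_; _<_; z≤n; s≤s)
open import Data.Nat.Properties
  using ( ≤-irrelevant; ≤-antisym; ≤-refl; ≤-reflexive; ≤-trans; <⇒≤; n≤1+n; n<1+n; m≤n⇒m<n∨m≡n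
        ; 1+n≢n; 1+n≰n; m≢1+n+m; suc-injective; m≤n+m; m≤m+n; m≤m*n; m^n≢0; ^-monoˡ-≤; +-monoʳ-≤ )
open import Data.Product using (Σ; _×_; _,_; proj₁; proj₂)
open import Data.Sum using (_⊎_; inj₁; inj₂)
open import Data.Unit using (⊤; tt)
open import Data.Vec using (tabulate)
open import Data.Vec.Properties using (lookup∘tabulate; []=⇒lookup; lookup⇒[]=)
open import Function using (_∘_)
open import Relation.Binary.PropositionalEquality
  using (_≡_; _≢_; _≗_; refl; sym; trans; cong; cong₂; subst)
open import Relation.Nullary using (¬_; Dec; yes; no; does; contradiction; _×-dec_; _→-dec_; ¬?)
open import Relation.Nullary.Decidable using (dec-true)

module _ {A : Set} where

  Child : List A → List A → Set
  Child x y = Σ A λ c → x ≡ c ∷ y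

  Neighbour : List A → List A → Set
  Neighbour x y = Child x y ⊎ Child y x

  length-child : ∀ {x y} → Child x y → length x ≡ suc (length y)
  length-child (_ , refl) = refl

  parent-unique : ∀ {x y z} → Child x y → Child x z → y ≡ z
  parent-unique (_ , refl) (_ , x≡) = ∷-injectiveʳ x≡

  neighbour-sym : ∀ {x y} → Neighbour x y → Neighbour y x
  neighbour-sym (inj₁ x◁y) = inj₂ x◁y
  neighbour-sym (inj₂ y◁x) = inj₁ y◁x

  neighbour-irrefl : ∀ {x} → ¬ Neighbour x x
  neighbour-irrefl (inj₁ (_ , x≡)) = m≢1+n+m _ {0} (cong length x≡)
  neighbour-irrefl (inj₂ (_ , x≡)) = m≢1+n+m _ {0} (cong length x≡)

  grandchild-common-neighbour : ∀ {x y z₁ z₂} → Child z₂ x → Child x z₁ →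
    Neighbour y z₁ → Neighbour y z₂ → y ≡ x
  grandchild-common-neighbour z₂◁x _ _ (inj₂ z₂◁y) = sym (parent-unique z₂◁x z₂◁y)
  grandchild-common-neighbour {z₁ = z₁} (_ , refl) (_ , refl) (inj₁ (_ , y≡)) (inj₁ (_ , refl)) =
    ⊥-elim (m≢1+n+m (length z₁) {1} (sym (cong length (∷-injectiveʳ y≡))))
  grandchild-common-neighbour {z₁ = z₁} (_ , refl) (_ , refl) (inj₂ (_ , z₁≡)) (inj₁ (_ , refl)) =
    ⊥-elim (m≢1+n+m (length z₁) {3} (cong length z₁≡))

  common-neighbour-unique : ∀ {x y z₁ z₂} → x ≢ y →
    Neighbour x z₁ → Neighbour y z₁ → Neighbour x z₂ → Neighbour y z₂ → z₁ ≡ z₂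
  common-neighbour-unique _ (inj₁ x◁z₁) _ (inj₁ x◁z₂) _ = parent-unique x◁z₁ x◁z₂
  common-neighbour-unique x≢y (inj₁ x◁z₁) y~z₁ (inj₂ z₂◁x) y~z₂ =
    contradiction (sym (grandchild-common-neighbour z₂◁x x◁z₁ y~z₁ y~z₂)) x≢y
  common-neighbour-unique x≢y (inj₂ z₁◁x) y~z₁ (inj₁ x◁z₂) y~z₂ =
    contradiction (sym (grandchild-common-neighbour z₁◁x x◁z₂ y~z₂ y~z₁)) x≢y
  common-neighbour-unique _ (inj₂ _) (inj₁ y◁z₁) (inj₂ _) (inj₁ y◁z₂) = parent-unique y◁z₁ y◁z₂
  common-neighbour-unique x≢y (inj₂ z₁◁x) (inj₂ z₁◁y) _ _ =
    contradiction (parent-unique z₁◁x z₁◁y) x≢y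
  common-neighbour-unique x≢y (inj₂ _) _ (inj₂ z₂◁x) (inj₂ z₂◁y) =
    contradiction (parent-unique z₂◁x z₂◁y) x≢y

  uncons : ∀ {j} (w : List A) → length w ≡ suc j →
    Σ A λ d → Σ (List A) λ y → w ≡ d ∷ y × length y ≡ j
  uncons (d ∷ y) refl = d , y , refl , refl

UniqueCommonNeighbours : ∀ {n} → Graph n → Set
UniqueCommonNeighbours {n} G = ∀ {u v w₁ w₂ : Fin n} → u ≢ v →
  Adj G u w₁ → Adj G v w₁ → Adj G u w₂ → Adj G v w₂ → w₁ ≡ w₂

uniqueCommonNeighbours⇒twoClosed : ∀ {n} {G : Graph n} → UniqueCommonNeighbours G → TwoClosed G
uniqueCommonNeighbours⇒twoClosed unique _ _ u≢v _ (_ , _ , w₁≢w₂ , u~w₁ , v~w₁ , u~w₂ , v~w₂) =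
  w₁≢w₂ (unique u≢v u~w₁ v~w₁ u~w₂ v~w₂)

module WordForest {A : Set} {n} (word : Fin n → List A) (Vertex : Fin n → Set)
  (word-injective : ∀ {u v} → Vertex u → Vertex v → word u ≡ word v → u ≡ v) where

  ForestAdj : Fin n → Fin n → Set
  ForestAdj u v = Vertex u × Vertex v × Neighbour (word u) (word v)

  forest : Graph n
  forest = record
    { Adj    = ForestAdj
    ; sym    = λ (u∈ , v∈ , u~v) → v∈ , u∈ , neighbour-sym u~v
    ; irrefl = λ (_ , _ , u~u) → neighbour-irrefl u~u
    }

  forest-uniqueCommonNeighbours : UniqueCommonNeighbours forest
  forest-uniqueCommonNeighbours u≢v (u∈ , w₁∈ , u~w₁) (v∈ , _ , v~w₁) (_ , w₂∈ , u~w₂) (_ , _ , v~w₂) =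
    word-injective w₁∈ w₂∈ (common-neighbour-unique (u≢v ∘ word-injective u∈ v∈) u~w₁ v~w₁ u~w₂ v~w₂)

  parent-vertex-unique : ∀ {u r c} → Vertex r → Vertex c →
    Child (word u) (word r) → Child (word u) (word c) → r ≡ c
  parent-vertex-unique r∈ c∈ u◁r u◁c = word-injective r∈ c∈ (parent-unique u◁r u◁c)

module BlowUp {n} {G : Graph n} {V : Set} {E : V → V → Set} {U : V → Set} {S : Subset n}
              (B : IsBlowUp G V E U S) where

  part : Fin n → V
  part = proj₁ B

  rep : V → Fin n
  rep x = proj₁ (proj₁ (proj₂ B) x)

  rep∈S : ∀ x → rep x ∈ S
  rep∈S x = proj₁ (proj₂ (proj₁ (proj₂ B) x))

  part-rep : ∀ x → part (rep x) ≡ x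
  part-rep x = proj₂ (proj₂ (proj₁ (proj₂ B) x))

  adj-rep : ∀ {u y} → u ∈ S → E (part u) y → Adj G u (rep y)
  adj-rep {u} {y} u∈S e =
    proj₁ (proj₂ (proj₂ B)) u (rep y) u∈S (rep∈S y) (subst (E (part u)) (sym (part-rep y)) e)

  rep-injective : ∀ {y₁ y₂} → rep y₁ ≡ rep y₂ → y₁ ≡ y₂
  rep-injective {y₁} {y₂} r≡ = trans (sym (part-rep y₁)) (trans (cong part r≡) (part-rep y₂))

  fibre-unique : UniqueCommonNeighbours G → ∀ {x y₁ y₂} → E x y₁ → E x y₂ → y₁ ≢ y₂ →
    ∀ {u v} → u ∈ S → v ∈ S → part u ≡ x → part v ≡ x → u ≡ v
  fibre-unique unique e₁ e₂ y₁≢y₂ {u} {v} u∈S v∈S refl v↦x with u ≟ v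
  ... | yes u≡v = u≡v
  ... | no u≢v  = contradiction (rep-injective (unique u≢v (adj-rep u∈S e₁) (adj-rep v∈S e₁′)
                                                         (adj-rep u∈S e₂) (adj-rep v∈S e₂′))) y₁≢y₂
    where
    e₁′ = subst (λ z → E z _) (sym v↦x) e₁
    e₂′ = subst (λ z → E z _) (sym v↦x) e₂

  neighbours-equal : ∀ {u} → u ∈ S → (∀ {a b} → Adj G u a → Adj G u b → a ≡ b) →
    ∀ {y₁ y₂} → E (part u) y₁ → E (part u) y₂ → y₁ ≡ y₂
  neighbours-equal u∈S unique e₁ e₂ = rep-injective (unique (adj-rep u∈S e₁) (adj-rep u∈S e₂))

module _ {n} {P : Fin n → Set} (P? : ∀ u → Dec (P u)) where

  subsetOf : Subset n
  subsetOf = tabulate (does ∘ P?)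

  ∈-subsetOf⁺ : ∀ {u} → P u → u ∈ subsetOf
  ∈-subsetOf⁺ {u} p = lookup⇒[]= u subsetOf (trans (lookup∘tabulate (does ∘ P?) u) (dec-true (P? u) p))

  ∈-subsetOf⁻ : ∀ {u} → u ∈ subsetOf → P u
  ∈-subsetOf⁻ {u} u∈ with P? u | trans (sym (lookup∘tabulate (does ∘ P?) u)) ([]=⇒lookup u∈)
  ... | yes p | _  = p
  ... | no _  | ()

funToFin-cong : ∀ {a b} {f g : Fin a → Fin b} → f ≗ g → funToFin f ≡ funToFin g
funToFin-cong {zero}  f≗g = refl
funToFin-cong {suc a} f≗g = cong₂ combine (f≗g zero) (funToFin-cong (f≗g ∘ suc))

-- Words of length ≤ k over Fin a, stored as k digits in base 1 + a with the digit 0 ending the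
-- word. decode is onto these words but not injective.
module BoundedWords (a k : ℕ) where

  cons-or-stop : Fin (suc a) → List (Fin a) → List (Fin a)
  cons-or-stop zero    _ = []
  cons-or-stop (suc c) w = c ∷ w

  digits→word : ∀ {j} → (Fin j → Fin (suc a)) → List (Fin a)
  digits→word {zero}  f = []
  digits→word {suc j} f = cons-or-stop (f zero) (digits→word (f ∘ suc))

  word→digits : ∀ {j} → List (Fin a) → Fin j → Fin (suc a)
  word→digits []      _       = zero
  word→digits (c ∷ w) zero    = suc c
  word→digits (c ∷ w) (suc i) = word→digits w i

  digits→word-cong : ∀ {j} {f g : Fin j → Fin (suc a)} → f ≗ g → digits→word f ≡ digits→word g
  digits→word-cong {zero}  f≗g = refl
  digits→word-cong {suc j} f≗g = cong₂ cons-or-stop (f≗g zero) (digits→word-cong (f≗g ∘ suc))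

  digits→word∘word→digits : ∀ {j} w → length w ≤ j → digits→word {j} (word→digits w) ≡ w
  digits→word∘word→digits {zero}  []      _           = refl
  digits→word∘word→digits {suc j} []      _           = refl
  digits→word∘word→digits {suc j} (c ∷ w) (s≤s |w|≤j) = cong (c ∷_) (digits→word∘word→digits w |w|≤j)

  length-digits→word : ∀ {j} (f : Fin j → Fin (suc a)) → length (digits→word f) ≤ j
  length-digits→word {zero}  f = z≤n
  length-digits→word {suc j} f with f zero
  ... | zero  = z≤n
  ... | suc c = s≤s (length-digits→word (f ∘ suc))

  -- Opaque, so that Fin size is never unfolded to Fin (suc a ^ k) during type checking.
  opaque
    size : ℕ
    size = suc a ^ k

    size≡ : size ≡ suc a ^ k
    size≡ = refl

    decode : Fin size → List (Fin a)
    decode = digits→word ∘ finToFun {suc a} {k}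

    encode : List (Fin a) → Fin size
    encode = funToFin {k} ∘ word→digits

    decode-encode : ∀ w → length w ≤ k → decode (encode w) ≡ w
    decode-encode w |w|≤k =
      trans (digits→word-cong (finToFun-funToFin (word→digits {k} w))) (digits→word∘word→digits w |w|≤k)

    length-decode : ∀ u → length (decode u) ≤ k
    length-decode = length-digits→word ∘ finToFun {suc a} {k}

module CompleteTree (k h : ℕ) where

  Tree : Set
  Tree = TreeV (2 + k) h

  tree-≡ : ∀ {x y : Tree} → proj₁ x ≡ proj₁ y → x ≡ y
  tree-≡ {w , p} {.w , q} refl = cong (w ,_) (≤-irrelevant p q)

  has-neighbour : 1 ≤ h → (x : Tree) → Σ Tree (TreeAdj x)
  has-neighbour 1≤h ([]    , _) = (zero ∷ [] , 1≤h) , inj₂ (zero , refl)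
  has-neighbour _   (d ∷ y , p) = (y , <⇒≤ p) , inj₁ (d , refl)

  non-leaf-neighbours : (x : Tree) → length (proj₁ x) < h →
    Σ Tree λ y₁ → Σ Tree λ y₂ → TreeAdj x y₁ × TreeAdj x y₂ × y₁ ≢ y₂
  non-leaf-neighbours (w , _) lt =
    (zero ∷ w , lt) , (suc zero ∷ w , lt) , inj₂ (zero , refl) , inj₂ (suc zero , refl) ,
    λ eq → 0≢1 (∷-injectiveˡ (cong proj₁ eq))
    where
    0≢1 : zero ≢ suc zero
    0≢1 ()

  neighbours-equal⇒leaf : (x : Tree) → (∀ {y₁ y₂} → TreeAdj x y₁ → TreeAdj x y₂ → y₁ ≡ y₂) →
    length (proj₁ x) ≡ h
  neighbours-equal⇒leaf x unique with m≤n⇒m<n∨m≡n (proj₂ x)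
  ... | inj₂ leaf = leaf
  ... | inj₁ lt   = let _ , _ , e₁ , e₂ , y₁≢y₂ = non-leaf-neighbours x lt in
                    contradiction (unique e₁ e₂) y₁≢y₂

module Construction (t k : ℕ) where

  h m : ℕ
  h = 3 + t
  m = 2 + k

  open CompleteTree k h

  Letter : Set
  Letter = Fin (suc m)

  Word : Set
  Word = List Letter

  lower : Letter → Fin m
  lower zero    = zero
  lower (suc c) = c

  twin : Fin 2 → Letter
  twin zero    = zero
  twin (suc _) = suc zero

  twin≢suc-suc : ∀ b {c} → twin b ≢ suc (suc c)
  twin≢suc-suc zero       ()
  twin≢suc-suc (suc zero) ()

  open BoundedWords (suc m) h public renaming (size to n; size≡ to n≡)

  -- The extra letter 0 occurs only at depth h - 1.
  Allowed : Word → Set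
  Allowed []      = ⊤
  Allowed (c ∷ w) = (c ≡ zero → length w ≡ suc t) × Allowed w

  allowed? : ∀ w → Dec (Allowed w)
  allowed? []      = yes tt
  allowed? (c ∷ w) = ((c ≟ zero) →-dec (length w ℕ.≟ suc t)) ×-dec allowed? w

  -- The elements of Fin n that are not the code of an allowed word are isolated in the host.
  IsVertex : Fin n → Set
  IsVertex u = encode (decode u) ≡ u × Allowed (decode u)

  isVertex? : ∀ u → Dec (IsVertex u)
  isVertex? u = (encode (decode u) ≟ u) ×-dec allowed? (decode u)

  vertex-injective : ∀ {u v} → IsVertex u → IsVertex v → decode u ≡ decode v → u ≡ v
  vertex-injective (u≡ , _) (v≡ , _) eq = trans (sym u≡) (trans (cong encode eq) v≡)

  encode-isVertex : ∀ {w} → length w ≤ h → Allowed w → IsVertex (encode w)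
  encode-isVertex {w} |w|≤h aw =
    cong encode (decode-encode w |w|≤h) , subst Allowed (sym (decode-encode w |w|≤h)) aw

  open WordForest decode IsVertex vertex-injective public

  leaf-neighbour-is-parent : ∀ {u a} → length (decode u) ≡ h → ForestAdj u a → Child (decode u) (decode a)
  leaf-neighbour-is-parent _ (_ , _ , inj₁ u◁a) = u◁a
  leaf-neighbour-is-parent {a = a} leaf (_ , _ , inj₂ a◁u) =
    ⊥-elim (1+n≰n (subst (_≤ h) (trans (length-child a◁u) (cong suc leaf)) (length-decode a)))

  leaf-neighbours-equal : ∀ {u a b} → length (decode u) ≡ h → ForestAdj u a → ForestAdj u b → a ≡ b
  leaf-neighbours-equal leaf u~a u~b =
    parent-vertex-unique (proj₁ (proj₂ u~a)) (proj₁ (proj₂ u~b))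
      (leaf-neighbour-is-parent leaf u~a) (leaf-neighbour-is-parent leaf u~b)

  probe : Fin m → Word
  probe j = suc zero ∷ suc j ∷ replicate t (suc zero)

  |probe-parent| : ∀ (j : Fin m) → length (suc j ∷ replicate t (suc zero)) ≡ suc t
  |probe-parent| j = cong suc (length-replicate t)

  |probe|≤h : ∀ j → length (probe j) ≤ h
  |probe|≤h j = ≤-trans (≤-reflexive (cong suc (|probe-parent| j))) (n≤1+n _)

  allowed-ones : ∀ l → Allowed (replicate l (suc zero))
  allowed-ones zero    = tt
  allowed-ones (suc l) = (λ ()) , allowed-ones l

  probe-vertex : ∀ j → IsVertex (encode (probe j))
  probe-vertex j = encode-isVertex (|probe|≤h j) ((λ ()) , (λ ()) , allowed-ones t)

  -- Below a vertex q of depth h - 2, S β drops the child twin (excluded q) and its subtree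
  -- (excluded [] is never consulted, since h - 2 ≥ 1).
  module Selection (β : Fin m → Fin 2) where

    excluded : Word → Fin 2
    excluded []      = zero
    excluded (j ∷ _) = β (lower j)

    Selected : Word → Set
    Selected []      = ⊤
    Selected (c ∷ w) = (length w ≡ suc t → c ≢ twin (excluded w)) × Selected w

    selected? : ∀ w → Dec (Selected w)
    selected? []      = yes tt
    selected? (c ∷ w) = ((length w ℕ.≟ suc t) →-dec ¬? (c ≟ twin (excluded w))) ×-dec selected? w

    short⇒selected : ∀ w → length w ≤ suc t → Selected w
    short⇒selected []      _           = tt
    short⇒selected (c ∷ w) (s≤s |w|≤t) =
      (λ |w|≡ → ⊥-elim (1+n≰n (subst (_≤ t) |w|≡ |w|≤t))) , short⇒selected w (≤-trans |w|≤t (n≤1+n t))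

    InS : Fin n → Set
    InS u = IsVertex u × Selected (decode u)

    inS? : ∀ u → Dec (InS u)
    inS? u = isVertex? u ×-dec selected? (decode u)

    S : Subset n
    S = subsetOf inS?

    lift-letter : (d : Fin m) (w : Word) → Σ Letter λ c → lower c ≡ d ×
      (c ≡ zero → length w ≡ suc t) × (length w ≡ suc t → c ≢ twin (excluded w))
    lift-letter (suc d) w = suc (suc d) , refl , (λ ()) , λ _ eq → twin≢suc-suc (excluded w) (sym eq)
    lift-letter zero w with length w ℕ.≟ suc t | excluded w
    ... | no |w|≢  | _        = suc zero , refl , (λ ()) , λ |w|≡ → contradiction |w|≡ |w|≢
    ... | yes _    | zero     = suc zero , refl , (λ ()) , λ _ ()
    ... | yes |w|≡ | suc zero = zero , refl , (λ _ → |w|≡) , λ _ ()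

    lift : (x : List (Fin m)) → Σ Word λ w → Allowed w × Selected w × map lower w ≡ x
    lift []      = [] , tt , tt , refl
    lift (d ∷ x) with lift x
    ... | w , aw , sw , refl with lift-letter d w
    ... | c , refl , ac , sc = c ∷ w , (ac , aw) , (sc , sw) , refl

    twins-not-both : ∀ b → zero ≢ twin b → suc zero ≢ twin b → ⊥
    twins-not-both zero       z≢ _  = z≢ refl
    twins-not-both (suc zero) _  o≢ = o≢ refl

    letter-unique : ∀ {c c′ w} → lower c ≡ lower c′ → Allowed (c ∷ w) → Selected (c ∷ w) →
      Allowed (c′ ∷ w) → Selected (c′ ∷ w) → c ≡ c′
    letter-unique {zero}     {zero}         _    _        _        _ _ = refl
    letter-unique {suc c}    {suc .c}       refl _        _        _ _ = refl
    letter-unique {zero}     {suc zero} {w} refl (z⇒ , _) (s₀ , _) _ (s₁ , _) =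
      ⊥-elim (twins-not-both (excluded w) (s₀ (z⇒ refl)) (s₁ (z⇒ refl)))
    letter-unique {suc zero} {zero}     {w} refl _ (s₁ , _) (z⇒ , _) (s₀ , _) =
      ⊥-elim (twins-not-both (excluded w) (s₀ (z⇒ refl)) (s₁ (z⇒ refl)))

    map-lower-injective : ∀ {w w′} → Allowed w → Selected w → Allowed w′ → Selected w′ →
      map lower w ≡ map lower w′ → w ≡ w′
    map-lower-injective {[]}    {[]}      _  _  _   _   _  = refl
    map-lower-injective {c ∷ w} {c′ ∷ w′} aw sw aw′ sw′ eq
      with map-lower-injective (proj₂ aw) (proj₂ sw) (proj₂ aw′) (proj₂ sw′) (∷-injectiveʳ eq)
    ... | refl = cong (_∷ w) (letter-unique (∷-injectiveˡ eq) aw sw aw′ sw′)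

    lower-child : ∀ {x y d} → Allowed x → Selected x → Allowed y → Selected y →
      map lower x ≡ d ∷ map lower y → Child x y
    lower-child {c ∷ x} (_ , ax) (_ , sx) ay sy eq =
      c , cong (c ∷_) (map-lower-injective ax sx ay sy (∷-injectiveʳ eq))

    φ : Fin n → Tree
    φ u = map lower (decode u) , subst (_≤ h) (sym (length-map lower (decode u))) (length-decode u)

    ∈S⇒ : ∀ {u} → u ∈ S → IsVertex u × Allowed (decode u) × Selected (decode u)
    ∈S⇒ u∈ = let vu , su = ∈-subsetOf⁻ inS? u∈ in vu , proj₂ vu , su

    φ-injective : ∀ {u v} → u ∈ S → v ∈ S → φ u ≡ φ v → u ≡ v
    φ-injective u∈ v∈ eq =
      let vu , au , su = ∈S⇒ u∈ ; vv , av , sv = ∈S⇒ v∈ in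
      vertex-injective vu vv (map-lower-injective au su av sv (cong proj₁ eq))

    φ-onto : ∀ x → Σ (Fin n) λ v → v ∈ S × φ v ≡ x
    φ-onto (x , |x|≤h) with lift x
    ... | w , aw , sw , refl =
      encode w , ∈-subsetOf⁺ inS? (encode-isVertex |w|≤h aw , subst Selected (sym dec-w) sw) ,
      tree-≡ (cong (map lower) dec-w)
      where
      |w|≤h : length w ≤ h
      |w|≤h = subst (_≤ h) (length-map lower w) |x|≤h
      dec-w : decode (encode w) ≡ w
      dec-w = decode-encode w |w|≤h

    φ-edges : ∀ u v → u ∈ S → v ∈ S → TreeAdj (φ u) (φ v) → ForestAdj u v
    φ-edges u v u∈ v∈ u~v with ∈S⇒ u∈ | ∈S⇒ v∈ | u~v
    ... | vu , au , su | vv , av , sv | inj₁ (_ , eq) = vu , vv , inj₁ (lower-child au su av sv eq)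
    ... | vu , au , su | vv , av , sv | inj₂ (_ , eq) = vu , vv , inj₂ (lower-child av sv au su eq)

    blowUp : (U : Tree → Set) → IsBlowUp forest Tree TreeAdj U S
    blowUp U = φ , φ-onto , φ-edges ,
      λ u v u∈ v∈ u≢v φu≡φv _ → contradiction (φ-injective u∈ v∈ φu≡φv) u≢v

    BelowExcluded : Word → Set
    BelowExcluded w = Σ Word λ q → length q ≡ suc t ×
      (w ≡ twin (excluded q) ∷ q ⊎ Σ Letter λ b → w ≡ b ∷ twin (excluded q) ∷ q)

    unselected⇒belowExcluded : ∀ w → length w ≤ h → ¬ Selected w → BelowExcluded w
    unselected⇒belowExcluded []      _ ¬s = contradiction tt ¬s
    unselected⇒belowExcluded (c ∷ w) |cw|≤h ¬s with selected? w
    ... | no ¬sw with unselected⇒belowExcluded w (≤-trans (n≤1+n _) |cw|≤h) ¬sw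
    ...   | q , |q| , inj₁ refl       = q , |q| , inj₂ (c , refl)
    ...   | q , |q| , inj₂ (_ , refl) = ⊥-elim (1+n≰n (subst (λ l → 3 + l ≤ h) |q| |cw|≤h))
    unselected⇒belowExcluded (c ∷ w) _ ¬s | yes sw with length w ℕ.≟ suc t | c ≟ twin (excluded w)
    ... | yes |w| | yes refl = w , |w| , inj₁ refl
    ... | yes _   | no c≢    = contradiction ((λ _ → c≢) , sw) ¬s
    ... | no |w|≢ | _        = contradiction ((λ |w| → contradiction |w| |w|≢) , sw) ¬s

    below-allowed : ∀ {w} → Allowed w → (b : BelowExcluded w) → Allowed (proj₁ b)
    below-allowed aw (_ , _ , inj₁ refl)       = proj₂ aw
    below-allowed aw (_ , _ , inj₂ (_ , refl)) = proj₂ (proj₂ aw)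

    module Maximality (U : Tree → Set) {S′ : Subset n} (B : IsBlowUp forest Tree TreeAdj U S′) where
      open BlowUp {G = forest} {V = Tree} {E = TreeAdj} {U = U} {S = S′} B

      shape : Fin n → List (Fin m)
      shape u = proj₁ (part u)

      shape-rep : ∀ x → shape (rep x) ≡ proj₁ x
      shape-rep x = cong proj₁ (part-rep x)

      ∈S′⇒vertex : ∀ {u} → u ∈ S′ → IsVertex u
      ∈S′⇒vertex {u} u∈ = let y , u~y = has-neighbour (s≤s z≤n) (part u) in proj₁ (adj-rep {y = y} u∈ u~y)

      non-leaf-fibre-unique : ∀ {u v} → u ∈ S′ → v ∈ S′ → part u ≡ part v →
        length (shape u) < h → u ≡ v
      non-leaf-fibre-unique {u} u∈ v∈ eq lt =
        let _ , _ , e₁ , e₂ , y₁≢y₂ = non-leaf-neighbours (part u) lt in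
        fibre-unique forest-uniqueCommonNeighbours e₁ e₂ y₁≢y₂ u∈ v∈ refl (sym eq)

      leaf⇒part-leaf : ∀ {u} → u ∈ S′ → length (decode u) ≡ h → length (shape u) ≡ h
      leaf⇒part-leaf {u} u∈ leaf = neighbours-equal⇒leaf (part u) (neighbours-equal u∈ (leaf-neighbours-equal leaf))

      -- The representative r of the parent of part u is a neighbour of u; it is not a child of
      -- u, as then r would be a leaf of the host lying over the non-leaf y.
      parent-part : ∀ {u c d y} → u ∈ S′ → IsVertex c → Child (decode u) (decode c) →
        suc (suc t) ≤ length (decode u) → shape u ≡ d ∷ y → c ∈ S′ × shape c ≡ y
      parent-part {u} {c} {d} {y} u∈ vc u◁c deep shape-u with adj-rep u∈ (inj₁ (d , shape-u))
      ... | _ , vr , inj₁ u◁r = subst (_∈ S′) r≡c (rep∈S _) , subst (λ z → shape z ≡ y) r≡c (shape-rep _)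
        where r≡c = parent-vertex-unique vr vc u◁r u◁c
      ... | _ , _ , inj₂ r◁u = ⊥-elim (1+n≰n (subst (λ l → suc l ≤ h) |y|≡h |dy|≤h))
        where
        |dy|≤h : length (d ∷ y) ≤ h
        |dy|≤h = subst (λ w → length w ≤ h) shape-u (proj₂ (part u))
        r = rep (y , <⇒≤ |dy|≤h)
        r-leaf : length (decode r) ≡ h
        r-leaf = ≤-antisym (length-decode r) (subst (h ≤_) (sym (length-child r◁u)) (s≤s deep))
        |y|≡h : length y ≡ h
        |y|≡h = trans (sym (cong length (shape-rep _))) (leaf⇒part-leaf (rep∈S _) r-leaf)

      record ChildPart (q c : Fin n) : Set where
        field
          c∈S′    : c ∈ S′
          depth-q : length (shape q) ≡ suc t
          letter  : Fin m
          shape-c : shape c ≡ letter ∷ shape q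

      child-part : ∀ {q c ℓ a b} → IsVertex q → IsVertex c → decode c ≡ a ∷ decode q →
        ℓ ∈ S′ → decode ℓ ≡ b ∷ decode c → length (decode ℓ) ≡ h → ChildPart q c
      child-part {q} {c} {ℓ} {a} {b} vq vc dec-c ℓ∈ dec-ℓ |ℓ|
        with uncons (shape ℓ) (leaf⇒part-leaf ℓ∈ |ℓ|)
      ... | _ , y , shape-ℓ , |y|
        with parent-part ℓ∈ vc (b , dec-ℓ) (≤-trans (n≤1+n _) (≤-reflexive (sym |ℓ|))) shape-ℓ
      ... | c∈ , shape-c with uncons y |y|
      ... | d , y′ , refl , |y′|
        with parent-part c∈ vq (a , dec-c) (≤-reflexive (suc-injective (trans (sym |ℓ|) (cong length dec-ℓ))))
                         shape-c
      ... | _ , shape-q = record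
        { c∈S′ = c∈ ; depth-q = trans (cong length shape-q) |y′| ; letter = d
        ; shape-c = trans shape-c (cong (d ∷_) (sym shape-q)) }

      module Siblings (qw : Word) (|qw| : length qw ≡ suc t) (allowed-qw : Allowed qw) where

        e : Letter
        e = twin (excluded qw)

        |qw|≤h : length qw ≤ h
        |qw|≤h = subst (_≤ h) (sym |qw|) (≤-trans (n≤1+n _) (n≤1+n _))

        |aqw|≤h : ∀ a → length (a ∷ qw) ≤ h
        |aqw|≤h a = subst (λ l → suc l ≤ h) (sym |qw|) (n≤1+n _)

        |baqw|≡h : ∀ a b → length (b ∷ a ∷ qw) ≡ h
        |baqw|≡h a b = cong (λ l → suc (suc l)) |qw|

        q : Fin n
        q = encode qw

        sibling nephew : Letter → Fin n
        sibling a = encode (a ∷ qw)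
        nephew a  = encode (suc zero ∷ a ∷ qw)

        decode-q : decode q ≡ qw
        decode-q = decode-encode qw |qw|≤h

        decode-sibling : ∀ a → decode (sibling a) ≡ a ∷ qw
        decode-sibling a = decode-encode (a ∷ qw) (|aqw|≤h a)

        decode-nephew : ∀ a → decode (nephew a) ≡ suc zero ∷ a ∷ qw
        decode-nephew a = decode-encode (suc zero ∷ a ∷ qw) (≤-reflexive (|baqw|≡h a (suc zero)))

        q-vertex : IsVertex q
        q-vertex = encode-isVertex |qw|≤h allowed-qw

        sibling-vertex : ∀ a → IsVertex (sibling a)
        sibling-vertex a = encode-isVertex (|aqw|≤h a) ((λ _ → |qw|) , allowed-qw)

        nephew-vertex : ∀ a → IsVertex (nephew a)
        nephew-vertex a = encode-isVertex (≤-reflexive (|baqw|≡h a (suc zero))) ((λ ()) , (λ _ → |qw|) , allowed-qw)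

        LeafBelow : Letter → Set
        LeafBelow a = Σ (Fin n) λ ℓ → ℓ ∈ S′ × Σ Letter λ b → decode ℓ ≡ b ∷ a ∷ qw

        sibling-part : ∀ a → LeafBelow a → ChildPart q (sibling a)
        sibling-part a (ℓ , ℓ∈ , b , dec-ℓ) =
          child-part q-vertex (sibling-vertex a) (trans (decode-sibling a) (cong (a ∷_) (sym decode-q)))
            ℓ∈ (trans dec-ℓ (cong (b ∷_) (sym (decode-sibling a)))) (trans (cong length dec-ℓ) (|baqw|≡h a b))

        module _ (leaf : ∀ a → LeafBelow a) where
          open ChildPart

          part-of : ∀ a → ChildPart q (sibling a)
          part-of a = sibling-part a (leaf a)

          letter-of : Letter → Fin m
          letter-of a = letter (part-of a)

          siblings-merge : ∀ {i j} → letter-of i ≡ letter-of j → sibling i ≡ sibling j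
          siblings-merge {i} {j} dᵢ≡dⱼ =
            non-leaf-fibre-unique (c∈S′ (part-of i)) (c∈S′ (part-of j)) (tree-≡ shapeᵢ≡shapeⱼ) non-leaf
            where
            shapeᵢ≡shapeⱼ : shape (sibling i) ≡ shape (sibling j)
            shapeᵢ≡shapeⱼ =
              trans (shape-c (part-of i)) (trans (cong (_∷ shape q) dᵢ≡dⱼ) (sym (shape-c (part-of j))))
            non-leaf : length (shape (sibling i)) < h
            non-leaf =
              subst (_< h) (sym (trans (cong length (shape-c (part-of i))) (cong suc (depth-q (part-of i))))) ≤-refl

          all-leaves-below⇒⊥ : ⊥
          all-leaves-below⇒⊥ =
            let i , j , i<j , dᵢ≡dⱼ = pigeonhole (n<1+n m) letter-of in
            Fin.<⇒≢ i<j (∷-injectiveˡ (trans (sym (decode-sibling i))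
                                     (trans (cong decode (siblings-merge dᵢ≡dⱼ)) (decode-sibling j))))

        nephew∈S : ∀ a → a ≢ e → nephew a ∈ S
        nephew∈S a a≢e = ∈-subsetOf⁺ inS? (nephew-vertex a , subst Selected (sym (decode-nephew a)) selected)
          where
          selected : Selected (suc zero ∷ a ∷ qw)
          selected = (λ |aqw| → ⊥-elim (1+n≢n (trans (cong suc (sym |qw|)) |aqw|))) ,
                     (λ _ → a≢e) , short⇒selected qw (≤-reflexive |qw|)

        kept-leaf : S ⊆ S′ → ∀ a → a ≢ e → LeafBelow a
        kept-leaf S⊆S′ a a≢e = nephew a , S⊆S′ (nephew∈S a a≢e) , suc zero , decode-nephew a

        module _ {x} (x∈ : x ∈ S′) (dec-x : decode x ≡ e ∷ qw) where

          leaf-from-neighbour : ∀ {r} → r ∈ S′ → ForestAdj x r → r ≢ q → LeafBelow e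
          leaf-from-neighbour r∈ (_ , vr , inj₁ x◁r) r≢q =
            contradiction (vertex-injective vr q-vertex (parent-unique x◁r (e , trans dec-x (cong (e ∷_) (sym decode-q)))))
                          r≢q
          leaf-from-neighbour {r} r∈ (_ , _ , inj₂ (b , dec-r)) _ = r , r∈ , b , trans dec-r (cong (b ∷_) dec-x)

          -- If part x is not a leaf, the representatives of two of its neighbours are adjacent to
          -- x and cannot both be q; if it is a leaf, its parent lies too deep to be part q.
          excluded-leaf : length (shape q) ≡ suc t → LeafBelow e
          excluded-leaf |q| with m≤n⇒m<n∨m≡n (proj₂ (part x))
          ... | inj₁ lt with non-leaf-neighbours (part x) lt
          ...   | y₁ , y₂ , e₁ , e₂ , y₁≢y₂ with rep y₁ ≟ q
          ...     | no r₁≢q  = leaf-from-neighbour (rep∈S y₁) (adj-rep {y = y₁} x∈ e₁) r₁≢q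
          ...     | yes r₁≡q = leaf-from-neighbour (rep∈S y₂) (adj-rep {y = y₂} x∈ e₂)
                                 λ r₂≡q → y₁≢y₂ (rep-injective (trans r₁≡q (sym r₂≡q)))
          excluded-leaf |q| | inj₂ leaf =
            let d₀ , y , shape-x , |y| = uncons (shape x) leaf
                y-bound = ≤-trans (≤-reflexive |y|) (n≤1+n _)
            in leaf-from-neighbour (rep∈S (y , y-bound)) (adj-rep {y = y , y-bound} x∈ (inj₁ (d₀ , shape-x)))
                 λ r≡q → 1+n≢n (trans (sym |y|) (trans (cong length (sym (shape-rep (y , y-bound))))
                                                       (trans (cong (length ∘ shape) r≡q) |q|)))

      no-new-vertex : S ⊆ S′ → ∀ {x} → x ∈ S′ → ¬ x ∈ S → ⊥
      no-new-vertex S⊆S′ {x} x∈ x∉S = all-leaves-below⇒⊥ leaf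
        where
        vx = ∈S′⇒vertex x∈
        below : BelowExcluded (decode x)
        below = unselected⇒belowExcluded (decode x) (length-decode x) (λ s → x∉S (∈-subsetOf⁺ inS? (vx , s)))
        open Siblings (proj₁ below) (proj₁ (proj₂ below)) (below-allowed (proj₂ vx) below)
        |q| : length (shape q) ≡ suc t
        |q| = ChildPart.depth-q (sibling-part a₀ (kept-leaf S⊆S′ a₀ a₀≢e))
          where
          a₀ = suc (suc zero)
          a₀≢e : a₀ ≢ e
          a₀≢e a₀≡e = twin≢suc-suc (excluded (proj₁ below)) (sym a₀≡e)
        leaf-e : LeafBelow e
        leaf-e with proj₂ (proj₂ below)
        ... | inj₁ dec-x       = excluded-leaf x∈ dec-x |q|
        ... | inj₂ (b , dec-x) = x , x∈ , b , dec-x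
        leaf : ∀ a → LeafBelow a
        leaf a with a ≟ e
        ... | yes refl = leaf-e
        ... | no a≢e   = kept-leaf S⊆S′ a a≢e

    maximal : (U : Tree → Set) → IsMaximalBlowUp forest Tree TreeAdj U S
    maximal U = blowUp U , λ S′ (S⊆S′ , _ , x∈ , x∉S) B → Maximality.no-new-vertex U B S⊆S′ x∈ x∉S

    probe∈S⇒ : ∀ j → encode (probe j) ∈ S → β j ≡ zero
    probe∈S⇒ j p∈ = excluded-twin (β j) (proj₁ selected (|probe-parent| j))
      where
      selected : Selected (probe j)
      selected = subst Selected (decode-encode (probe j) (|probe|≤h j)) (proj₂ (∈-subsetOf⁻ inS? p∈))
      excluded-twin : ∀ b → suc zero ≢ twin b → b ≡ zero
      excluded-twin zero       _  = refl
      excluded-twin (suc zero) ne = ⊥-elim (ne refl)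

    ⇒probe∈S : ∀ j → β j ≡ zero → encode (probe j) ∈ S
    ⇒probe∈S j βj≡0 =
      ∈-subsetOf⁺ inS? (probe-vertex j , subst Selected (sym (decode-encode (probe j) (|probe|≤h j))) selected)
      where
      selected : Selected (probe j)
      selected = (λ _ → subst (λ b → suc zero ≢ twin b) (sym βj≡0) λ ()) ,
                 short⇒selected _ (≤-reflexive (|probe-parent| j))

  fin2-≡ : ∀ {b b′ : Fin 2} → (b ≡ zero → b′ ≡ zero) → (b′ ≡ zero → b ≡ zero) → b ≡ b′
  fin2-≡ {zero}     {zero}     _ _ = refl
  fin2-≡ {zero}     {suc zero} f _ = sym (f refl)
  fin2-≡ {suc zero} {zero}     _ g = g refl
  fin2-≡ {suc zero} {suc zero} _ _ = refl

  selection-injective : ∀ β β′ → Selection.S β ≡ Selection.S β′ → β ≗ β′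
  selection-injective β β′ eq j = fin2-≡
    (Selection.probe∈S⇒ β′ j ∘ subst (encode (probe j) ∈_) eq ∘ Selection.⇒probe∈S β j)
    (Selection.probe∈S⇒ β j ∘ subst (encode (probe j) ∈_) (sym eq) ∘ Selection.⇒probe∈S β′ j)

  selections : Fin (2 ^ m) → Subset n
  selections i = Selection.S (finToFun i)

  selections-injective : ∀ i j → selections i ≡ selections j → i ≡ j
  selections-injective i j eq =
    trans (sym (funToFin-finToFin {m} i)) (trans (funToFin-cong (selection-injective _ _ eq)) (funToFin-finToFin {m} j))

base≤power : ∀ b j .{{_ : ℕ.NonZero b}} → b ≤ b ^ suc j
base≤power b j = m≤m*n b (b ^ j) {{m^n≢0 b j}}

4+n≤2*[2+n] : ∀ n → 4 + n ≤ 2 * (2 + n)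
4+n≤2*[2+n] n = s≤s (s≤s (≤-trans (m≤n+m (2 + n) n) (+-monoʳ-≤ n (s≤s (s≤s (m≤m+n n 0))))))

lemma1 : (h : ℕ) → 3 ≤ h →
    Σ ℕ λ a → Σ ℕ λ b → 1 ≤ a × 1 ≤ b ×
    ((U : (m : ℕ) → TreeV m h → Set) → (N : ℕ) →
      Σ ℕ λ n → N ≤ n × Σ (Graph n) λ G → TwoClosed G ×
      Σ ℕ λ m → 2 ≤ m × Σ ℕ λ k → n ≤ (a * k) ^ b ×
      Σ (Fin (2 ^ k) → Subset n) λ f →
        (∀ i j → f i ≡ f j → i ≡ j) ×
        (∀ i → IsMaximalBlowUp G (TreeV m h) (TreeAdj {m} {h}) (U m) (f i)))
lemma1 (suc (suc (suc t))) (s≤s (s≤s (s≤s _))) = 2 , 3 + t , s≤s z≤n , s≤s z≤n , λ U N →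
  let open Construction t N in
  n , subst (N ≤_) (sym n≡) (≤-trans (m≤n+m N 4) (base≤power (4 + N) (2 + t))) ,
  forest , uniqueCommonNeighbours⇒twoClosed {G = forest} forest-uniqueCommonNeighbours ,
  m , s≤s (s≤s z≤n) ,
  m , subst (_≤ (2 * m) ^ h) (sym n≡) (^-monoˡ-≤ h (4+n≤2*[2+n] N)) ,
  selections , selections-injective , λ i → Selection.maximal (finToFun i) (U m)
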